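{- Let $p\neq q$ be primes, let $\mathbf P$ be a finite abelian $p$-group and $\mathbf Q$ a finite abelian $q$-group, and let $\mathbf G=\mathbf P\times\mathbf Q$. Let $a\in P$ and $b\in Q$ with $a\neq e$, $b\neq e$, $a\notin M(\mathbf P)$ and $b\notin M(\mathbf Q)$. Then the neighborhood class of $(a,b)$ in $\mathcal D(\mathbf G)$ is $[(a,b)]=\{(x,y)\in P\times Q : \langle x\rangle=\langle a\rangle,\ \langle y\rangle=\langle b\rangle\}$.
   Context: $e$ denotes the identity element. For a finite group $\mathbf K$, $M(\mathbf K)$ is the set of all generators of maximal cyclic subgroups of $\mathbf K$. The power graph of a group $\mathbf K$ is the simple graph on $K$ in which two distinct elements are adjacent iff one is a power of the other; the enhanced power graph of $\mathbf K$ is the simple graph on $K$ in which two distinct elements are adjacent iff they generate a cyclic subgroup. The difference graph $\mathcal D(\mathbf K)$ is the graph whose edges are the pairs adjacent in the enhanced power graph but not in the power graph, with all isolated vertices removed. For a vertex $v$ of a graph, its neighborhood class $[v]$ is the set of all vertices having the same neighborhood (set of neighbors) as $v$. -}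

module Defs where

open import Level using (Level; _⊔_; 0ℓ)
open import Algebra.Bundles using (AbelianGroup)
open import Algebra.Construct.DirectProduct using (abelianGroup)
open import Data.Nat using (ℕ; zero; suc; _^_)
open import Data.Nat.Primality using (Prime)
open import Data.Fin using (Fin)
open import Data.Product using (Σ; ∃; _×_; _,_; proj₁; proj₂)
open import Data.Sum using (_⊎_)
open import Relation.Nullary using (¬_)
open import Relation.Binary.PropositionalEquality using (_≡_)

infix 3 _⇔_
_⇔_ : ∀ {a b} → Set a → Set b → Set (a ⊔ b)
A ⇔ B = (A → B) × (B → A)

module AbGroupNotions {c ℓ : Level} (K : AbelianGroup c ℓ) where
  open AbelianGroup K renaming (_∙_ to _·_; ε to e)

  pow : Carrier → ℕ → Carrier
  pow x zero    = e
  pow x (suc m) = x · pow x m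

  -- membership in the cyclic subgroup ⟨ x ⟩ (K finite, so ℕ-powers suffice)
  infix 5 _∈⟨_⟩
  _∈⟨_⟩ : Carrier → Carrier → Set ℓ
  y ∈⟨ x ⟩ = ∃ λ (m : ℕ) → y ≈ pow x m

  -- membership in the subgroup ⟨ x , y ⟩ generated by x and y (K abelian)
  InGen2 : Carrier → Carrier → Carrier → Set ℓ
  InGen2 w x y = ∃ λ (i : ℕ) → ∃ λ (j : ℕ) → w ≈ (pow x i · pow y j)

  CycSub : Carrier → Carrier → Set (c ⊔ ℓ)
  CycSub x z = ∀ w → w ∈⟨ x ⟩ → w ∈⟨ z ⟩

  SameCyc : Carrier → Carrier → Set (c ⊔ ℓ)
  SameCyc x a = ∀ w → (w ∈⟨ x ⟩ ⇔ w ∈⟨ a ⟩)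

  -- x generates a maximal cyclic subgroup, i.e. x ∈ M(K)
  InM : Carrier → Set (c ⊔ ℓ)
  InM x = ∀ z → CycSub x z → CycSub z x

  GenCyclic : Carrier → Carrier → Set (c ⊔ ℓ)
  GenCyclic x y = ∃ λ z → ∀ w → (InGen2 w x y ⇔ w ∈⟨ z ⟩)

  PowAdj : Carrier → Carrier → Set ℓ
  PowAdj x y = (¬ x ≈ y) × ((∃ λ (m : ℕ) → y ≈ pow x m) ⊎ (∃ λ (m : ℕ) → x ≈ pow y m))

  EnhAdj : Carrier → Carrier → Set (c ⊔ ℓ)
  EnhAdj x y = (¬ x ≈ y) × GenCyclic x y

  DiffAdj : Carrier → Carrier → Set (c ⊔ ℓ)
  DiffAdj x y = EnhAdj x y × ¬ PowAdj x y

  -- vertices of D(K): non-isolated vertices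
  DiffVertex : Carrier → Set (c ⊔ ℓ)
  DiffVertex x = ∃ λ y → DiffAdj x y

  InNbhdClass : Carrier → Carrier → Set (c ⊔ ℓ)
  InNbhdClass v u = DiffVertex u × (∀ w → (DiffAdj u w ⇔ DiffAdj v w))

record FiniteAbelianGroup : Set₁ where
  field
    abGroup : AbelianGroup 0ℓ 0ℓ
    order  : ℕ
    enum   : Fin order → AbelianGroup.Carrier abGroup
    enum-injective  : ∀ i j → AbelianGroup._≈_ abGroup (enum i) (enum j) → i ≡ j
    enum-surjective : ∀ x → ∃ λ i → AbelianGroup._≈_ abGroup (enum i) x
  open AbelianGroup abGroup public

IsPGroup : ℕ → FiniteAbelianGroup → Set
IsPGroup p K = ∃ λ (k : ℕ) → FiniteAbelianGroup.order K ≡ p ^ k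

_⊗_ : FiniteAbelianGroup → FiniteAbelianGroup → AbelianGroup 0ℓ 0ℓ
P ⊗ Q = abelianGroup (FiniteAbelianGroup.abGroup P) (FiniteAbelianGroup.abGroup Q)

-- In P × Q the cyclic subgroup ⟨(x , y)⟩ is ⟨x⟩ × ⟨y⟩, since |P| and |Q| are coprime (Chinese
-- remainder theorem), and the cyclic subgroups of a cyclic p-group form a chain.  Hence (x , y)
-- and (x′ , y′) are adjacent in D(P × Q) exactly when ⟨x′⟩ ⊊ ⟨x⟩ and ⟨y⟩ ⊊ ⟨y′⟩, or the other
-- way round.  This "crossed" relation only sees ⟨x⟩ and ⟨y⟩, which gives one inclusion.  For the
-- other, a non-maximal a lies strictly below some z, and b ≠ e lies strictly above e; comparing
-- the neighbourhoods of (x , y) and (a , b) at (z , e), (a , e) and (x , e) forces ⟨x⟩ = ⟨a⟩,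
-- and symmetrically ⟨y⟩ = ⟨b⟩.

module Submission where

open import Defs
open import Level using (_⊔_)
open import Algebra.Bundles using (AbelianGroup)
import Algebra.Properties.CommutativeMonoid.Mult as Mult
import Algebra.Properties.CommutativeMonoid.Sum as Sum
import Algebra.Properties.Group as GroupProperties
open import Data.Nat using (ℕ; zero; suc; _+_; _*_; _^_; pred; NonZero; _%_; _/_)
open import Data.Nat.Properties using (+-assoc; +-comm; +-identityʳ; *-comm; *-assoc; *-suc)
open import Data.Nat.DivMod using (m≡m%n+[m/n]*n; m%n<n)
open import Data.Nat.Divisibility
  using (_∣_; divides; _∣?_; 1∣_; ∣1⇒≡1; ∣-trans; *-monoˡ-∣; *-cancelʳ-∣)
open import Data.Nat.GCD using (gcd; gcd-GCD; gcd[m,n]∣m; gcd[m,n]∣n; module Bézout)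
open import Data.Nat.Coprimality
  using (Coprime; coprime-divisor; coprime-Bézout) renaming (sym to Coprime-sym)
open import Data.Nat.Primality using (Prime; prime⇒irreducible; prime⇒nonZero; ¬prime[1])
open import Data.Fin using (Fin; toℕ; fromℕ<)
open import Data.Fin.Properties using (any?; toℕ-fromℕ<; nonZeroIndex) renaming (_≟_ to _≟ᶠ_)
open import Data.Fin.Permutation using (Permutation′; permutation)
open import Data.Product using (∃; _×_; _,_; proj₁; proj₂)
import Data.Product as Prod
open import Data.Sum using (_⊎_; inj₁; inj₂; [_,_])
import Data.Sum as ⊎
open import Data.Empty using (⊥-elim)
open import Function using (_∘_)
open import Relation.Nullary using (¬_; yes; no)
open import Relation.Nullary.Decidable using (map′; decidable-stable; _×-dec_; ¬?)
open import Relation.Binary using (Rel; Preorder)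
open import Relation.Binary.Definitions using (Decidable; Minimum)
open import Relation.Binary.PropositionalEquality as ≡ using (_≡_; _≢_)

∤⇒coprime : ∀ {p d} → Prime p → ¬ p ∣ d → Coprime d p
∤⇒coprime p-prime p∤d {i} (i∣d , i∣p) with prime⇒irreducible p-prime i∣p
... | inj₁ i≡1 = i≡1
... | inj₂ ≡.refl = ⊥-elim (p∤d i∣d)

∣p^k⇒≡1⊎p∣ : ∀ {p d} → Prime p → ∀ k → d ∣ p ^ k → d ≡ 1 ⊎ p ∣ d
∣p^k⇒≡1⊎p∣ p-prime zero d∣1 = inj₁ (∣1⇒≡1 d∣1)
∣p^k⇒≡1⊎p∣ {p} {d} p-prime (suc k) d∣p^k+1 with p ∣? d
... | yes p∣d = inj₂ p∣d
... | no p∤d = ∣p^k⇒≡1⊎p∣ p-prime k (coprime-divisor (∤⇒coprime p-prime p∤d) d∣p^k+1)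

∣p^k-total : ∀ {p d e} → Prime p → ∀ k → d ∣ p ^ k → e ∣ p ^ k → d ∣ e ⊎ e ∣ d
∣p^k-total p-prime zero d∣1 _ with ∣1⇒≡1 d∣1
... | ≡.refl = inj₁ (1∣ _)
∣p^k-total {p} p-prime (suc k) d∣ e∣
  with ∣p^k⇒≡1⊎p∣ p-prime (suc k) d∣ | ∣p^k⇒≡1⊎p∣ p-prime (suc k) e∣
... | inj₁ ≡.refl | _ = inj₁ (1∣ _)
... | inj₂ _ | inj₁ ≡.refl = inj₂ (1∣ _)
... | inj₂ (divides d′ ≡.refl) | inj₂ (divides e′ ≡.refl) =
  ⊎.map (*-monoˡ-∣ p) (*-monoˡ-∣ p) (∣p^k-total p-prime k (cancel {d′} d∣) (cancel {e′} e∣))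
  where
  instance _ = prime⇒nonZero p-prime
  cancel : ∀ {c} → c * p ∣ p * p ^ k → c ∣ p ^ k
  cancel {c} h = *-cancelʳ-∣ p (≡.subst (c * p ∣_) (*-comm p (p ^ k)) h)

coprime-^ : ∀ {p q} → Prime p → Prime q → p ≢ q → ∀ k l → Coprime (p ^ k) (q ^ l)
coprime-^ p-prime q-prime p≢q k l {d} (d∣p^k , d∣q^l) with ∣p^k⇒≡1⊎p∣ p-prime k d∣p^k
... | inj₁ d≡1 = d≡1
... | inj₂ p∣d with ∣p^k⇒≡1⊎p∣ q-prime l (∣-trans p∣d d∣q^l)
...   | inj₁ ≡.refl = ⊥-elim (¬prime[1] p-prime)
...   | inj₂ q∣p with prime⇒irreducible p-prime q∣p
...     | inj₁ ≡.refl = ⊥-elim (¬prime[1] q-prime)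
...     | inj₂ q≡p = ⊥-elim (p≢q (≡.sym q≡p))

-- Read modulo n, this turns d + c ≡ 0 into d ≡ (n - 1) c without subtraction.
d+c≡y*n⇒d+c*n≡pred[n]*c+y*n : ∀ {d c y n} .{{_ : NonZero n}} →
                              d + c ≡ y * n → d + c * n ≡ pred n * c + y * n
d+c≡y*n⇒d+c*n≡pred[n]*c+y*n {d} {c} {y} {suc n} eq = begin
  d + c * suc n       ≡⟨ ≡.cong (d +_) (*-suc c n) ⟩
  d + (c + c * n)     ≡⟨ ≡.sym (+-assoc d c (c * n)) ⟩
  (d + c) + c * n     ≡⟨ ≡.cong (_+ c * n) eq ⟩
  y * suc n + c * n   ≡⟨ +-comm (y * suc n) (c * n) ⟩
  c * n + y * suc n   ≡⟨ ≡.cong (_+ y * suc n) (*-comm c n) ⟩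
  n * c + y * suc n   ∎
  where open ≡.≡-Reasoning

module StrictPart {a ℓ r} (P : Preorder a ℓ r) where
  open Preorder P

  infix 4 _<_ _≃_

  _<_ : Rel Carrier r
  x < y = x ≲ y × ¬ y ≲ x

  _≃_ : Rel Carrier r
  x ≃ y = x ≲ y × y ≲ x

  TotalBelow : Set (a ⊔ r)
  TotalBelow = ∀ {x y z} → x ≲ z → y ≲ z → x ≲ y ⊎ y ≲ x

  ≃-refl : ∀ {x} → x ≃ x
  ≃-refl = refl , refl

  <-irrefl : ∀ {x} → ¬ x < x
  <-irrefl (_ , x≴x) = x≴x refl

  <-resp-≃ : ∀ {x x′ y y′} → x ≃ x′ → y ≃ y′ → x < y → x′ < y′
  <-resp-≃ (x≲x′ , x′≲x) (y≲y′ , y′≲y) (x≲y , y≴x) =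
    trans x′≲x (trans x≲y y≲y′) , λ y′≲x′ → y≴x (trans y≲y′ (trans y′≲x′ x′≲x))

module CrossRelation {a₁ ℓ₁ r₁ a₂ ℓ₂ r₂} (P₁ : Preorder a₁ ℓ₁ r₁) (P₂ : Preorder a₂ ℓ₂ r₂) where
  open Preorder P₁ public using () renaming (Carrier to A; _≲_ to _≲₁_)
  open Preorder P₂ public using () renaming (Carrier to B; _≲_ to _≲₂_)
  open StrictPart P₁ public using ()
    renaming ( _<_ to _<₁_; _≃_ to _≃₁_; TotalBelow to TotalBelow₁
             ; ≃-refl to ≃₁-refl; <-irrefl to <₁-irrefl; <-resp-≃ to <₁-resp-≃)
  open StrictPart P₂ public using ()
    renaming ( _<_ to _<₂_; _≃_ to _≃₂_; TotalBelow to TotalBelow₂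
             ; ≃-refl to ≃₂-refl; <-resp-≃ to <₂-resp-≃)

  Cross : Rel (A × B) (r₁ ⊔ r₂)
  Cross (x , y) (x′ , y′) = (x′ <₁ x × y <₂ y′) ⊎ (x <₁ x′ × y′ <₂ y)

  SameNbhd : Rel (A × B) (a₁ ⊔ a₂ ⊔ r₁ ⊔ r₂)
  SameNbhd u v = ∀ w → Cross u w ⇔ Cross v w

  ¬Cross-fst : ∀ {x y y′} → ¬ Cross (x , y) (x , y′)
  ¬Cross-fst = [ <₁-irrefl ∘ proj₁ , <₁-irrefl ∘ proj₁ ]

  Cross-resp-≃ : ∀ {x y x′ y′ w} → x ≃₁ x′ → y ≃₂ y′ → Cross (x , y) w → Cross (x′ , y′) w
  Cross-resp-≃ x≃x′ y≃y′ (inj₁ (w<x , y<w)) =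
    inj₁ (<₁-resp-≃ ≃₁-refl x≃x′ w<x , <₂-resp-≃ y≃y′ ≃₂-refl y<w)
  Cross-resp-≃ x≃x′ y≃y′ (inj₂ (x<w , w<y)) =
    inj₂ (<₁-resp-≃ x≃x′ ≃₁-refl x<w , <₂-resp-≃ ≃₂-refl y≃y′ w<y)

  ≃⇒SameNbhd : ∀ {x y a b} → x ≃₁ a → y ≃₂ b → SameNbhd (x , y) (a , b)
  ≃⇒SameNbhd x≃a y≃b w = Cross-resp-≃ x≃a y≃b , Cross-resp-≃ (Prod.swap x≃a) (Prod.swap y≃b)

  SameNbhd⇒≃₁ : Decidable _≲₁_ → TotalBelow₁ → ∀ {⊥₂} → Minimum _≲₂_ ⊥₂ →
                ∀ {x y a b z} → ⊥₂ <₂ b → a <₁ z → SameNbhd (x , y) (a , b) → x ≃₁ a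
  SameNbhd⇒≃₁ _≲₁?_ total {⊥₂} least {x} {y} {a} {b} {z} ⊥<b a<z same
    with proj₂ (same (z , ⊥₂)) (inj₂ (a<z , ⊥<b))
  ... | inj₁ (_ , y<⊥) = ⊥-elim (proj₂ y<⊥ (least y))
  ... | inj₂ (x<z , ⊥<y) with total (proj₁ x<z) (proj₁ a<z)
  ...   | inj₁ x≲a = x≲a , decidable-stable (a ≲₁? x)
          (λ a≴x → ¬Cross-fst (proj₁ (same (a , ⊥₂)) (inj₂ ((x≲a , a≴x) , ⊥<y))))
  ...   | inj₂ a≲x = decidable-stable (x ≲₁? a)
          (λ x≴a → ¬Cross-fst (proj₂ (same (x , ⊥₂)) (inj₂ ((a≲x , x≴a) , ⊥<b)))) , a≲x

module _ {a₁ ℓ₁ r₁ a₂ ℓ₂ r₂} (P₁ : Preorder a₁ ℓ₁ r₁) (P₂ : Preorder a₂ ℓ₂ r₂) where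
  open CrossRelation P₁ P₂

  Cross-swap : ∀ {x y x′ y′} → Cross (x , y) (x′ , y′) → CrossRelation.Cross P₂ P₁ (y , x) (y′ , x′)
  Cross-swap = ⊎.swap ∘ ⊎.map Prod.swap Prod.swap

module _ {a₁ ℓ₁ r₁ a₂ ℓ₂ r₂} (P₁ : Preorder a₁ ℓ₁ r₁) (P₂ : Preorder a₂ ℓ₂ r₂) where
  open CrossRelation P₁ P₂

  SameNbhd⇒≃₂ : Decidable _≲₂_ → TotalBelow₂ → ∀ {⊥₁} → Minimum _≲₁_ ⊥₁ →
                ∀ {x y a b z} → ⊥₁ <₁ a → b <₂ z → SameNbhd (x , y) (a , b) → y ≃₂ b
  SameNbhd⇒≃₂ dec total least ⊥<a b<z same =
    CrossRelation.SameNbhd⇒≃₁ P₂ P₁ dec total least ⊥<a b<z λ (w₂ , w₁) →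
      Cross-swap P₁ P₂ ∘ proj₁ (same (w₁ , w₂)) ∘ Cross-swap P₂ P₁ ,
      Cross-swap P₁ P₂ ∘ proj₂ (same (w₁ , w₂)) ∘ Cross-swap P₂ P₁

module CyclicSubgroups {c ℓ} (K : AbelianGroup c ℓ) where
  open AbelianGroup K
  open AbGroupNotions K
  open Mult commutativeMonoid using (×-congʳ; ×-homo-+; ×-assocˡ; ×-distrib-+)
    renaming (_×_ to _·_)
  open import Relation.Binary.Reasoning.Setoid setoid

  pow≡· : ∀ x m → pow x m ≡ m · x
  pow≡· x zero = ≡.refl
  pow≡· x (suc m) = ≡.cong (x ∙_) (pow≡· x m)

  pow-cong : ∀ {x y} m → x ≈ y → pow x m ≈ pow y m
  pow-cong {x} {y} m x≈y rewrite pow≡· x m | pow≡· y m = ×-congʳ m x≈y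

  pow-homo-+ : ∀ x m n → pow x (m + n) ≈ pow x m ∙ pow x n
  pow-homo-+ x m n rewrite pow≡· x (m + n) | pow≡· x m | pow≡· x n = ×-homo-+ x m n

  pow-pow : ∀ x m n → pow (pow x m) n ≈ pow x (n * m)
  pow-pow x m n rewrite pow≡· x m | pow≡· (m · x) n | pow≡· x (n * m) = ×-assocˡ x n m

  pow-distrib-∙ : ∀ x y m → pow (x ∙ y) m ≈ pow x m ∙ pow y m
  pow-distrib-∙ x y m rewrite pow≡· (x ∙ y) m | pow≡· x m | pow≡· y m = ×-distrib-+ x y m

  pow-ε : ∀ m → pow ε m ≈ ε
  pow-ε zero = refl
  pow-ε (suc m) = trans (identityˡ _) (pow-ε m)

  pow-*-cong : ∀ {x z} e m → pow x e ≈ z → pow x (m * e) ≈ pow z m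
  pow-*-cong {x} e m xᵉ≈z = trans (sym (pow-pow x e m)) (pow-cong m xᵉ≈z)

  pow-+-*-cong : ∀ {x z z′} e f i j → pow x e ≈ z → pow x f ≈ z′ →
                 pow x (i * e + j * f) ≈ pow z i ∙ pow z′ j
  pow-+-*-cong {x} e f i j xᵉ≈z xᶠ≈z′ =
    trans (pow-homo-+ x (i * e) (j * f)) (∙-cong (pow-*-cong e i xᵉ≈z) (pow-*-cong f j xᶠ≈z′))

  ≈⇒∈⟨⟩ : ∀ {x y} → x ≈ y → x ∈⟨ y ⟩
  ≈⇒∈⟨⟩ {y = y} x≈y = 1 , trans x≈y (sym (identityʳ y))

  ∈⟨⟩-refl : ∀ {x} → x ∈⟨ x ⟩
  ∈⟨⟩-refl = ≈⇒∈⟨⟩ refl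

  ∈⟨⟩-trans : ∀ {x y z} → x ∈⟨ y ⟩ → y ∈⟨ z ⟩ → x ∈⟨ z ⟩
  ∈⟨⟩-trans {x} {y} {z} (m , x≈yᵐ) (n , y≈zⁿ) = m * n , (begin
    x                ≈⟨ x≈yᵐ ⟩
    pow y m          ≈⟨ pow-cong m y≈zⁿ ⟩
    pow (pow z n) m  ≈⟨ pow-pow z n m ⟩
    pow z (m * n)    ∎)

  ε∈⟨⟩ : ∀ {x} → ε ∈⟨ x ⟩
  ε∈⟨⟩ = 0 , refl

  pow∈⟨⟩ : ∀ {x} m → pow x m ∈⟨ x ⟩
  pow∈⟨⟩ m = m , refl

  ∙-∈⟨⟩ : ∀ {x y z} → x ∈⟨ z ⟩ → y ∈⟨ z ⟩ → x ∙ y ∈⟨ z ⟩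
  ∙-∈⟨⟩ {z = z} (m , x≈zᵐ) (n , y≈zⁿ) = m + n , trans (∙-cong x≈zᵐ y≈zⁿ) (sym (pow-homo-+ z m n))

  ∈⟨ε⟩⇒≈ε : ∀ {x} → x ∈⟨ ε ⟩ → x ≈ ε
  ∈⟨ε⟩⇒≈ε (m , x≈εᵐ) = trans x≈εᵐ (pow-ε m)

  ∣⇒pow∈⟨pow⟩ : ∀ {x d n} → d ∣ n → pow x n ∈⟨ pow x d ⟩
  ∣⇒pow∈⟨pow⟩ {x} {d} (divides k ≡.refl) = k , sym (pow-pow x d k)

  ∈⟨⟩-preorder : Preorder c ℓ ℓ
  ∈⟨⟩-preorder = record
    { Carrier = Carrier
    ; _≈_ = _≈_
    ; _≲_ = _∈⟨_⟩
    ; isPreorder = record { isEquivalence = isEquivalence ; reflexive = ≈⇒∈⟨⟩ ; trans = ∈⟨⟩-trans }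
    }

  open StrictPart ∈⟨⟩-preorder public using (_<_; _≃_; TotalBelow)

  ε-minimum : Minimum _∈⟨_⟩ ε
  ε-minimum _ = ε∈⟨⟩

  ε< : ∀ {x} → ¬ x ≈ ε → ε < x
  ε< x≉ε = ε∈⟨⟩ , x≉ε ∘ ∈⟨ε⟩⇒≈ε

  SameCyc⇔≃ : ∀ {x y} → SameCyc x y ⇔ x ≃ y
  SameCyc⇔≃ {x} {y} = (λ same → proj₁ (same x) ∈⟨⟩-refl , proj₂ (same y) ∈⟨⟩-refl) ,
                      (λ (x∈y , y∈x) w → (λ w∈x → ∈⟨⟩-trans w∈x x∈y) , (λ w∈y → ∈⟨⟩-trans w∈y y∈x))

  fst∈⟨,⟩ : ∀ {u v} → InGen2 u u v
  fst∈⟨,⟩ {u} = 1 , 0 , sym (trans (identityʳ _) (identityʳ u))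

  snd∈⟨,⟩ : ∀ {u v} → InGen2 v u v
  snd∈⟨,⟩ {v = v} = 0 , 1 , sym (trans (identityˡ _) (identityʳ v))

  InGen2-swap : ∀ {w u v} → InGen2 w u v → InGen2 w v u
  InGen2-swap (i , j , w≈) = j , i , trans w≈ (comm _ _)

  GenCyclic⇒∈⟨⟩ : ∀ {u v} → GenCyclic u v → ∃ λ z → u ∈⟨ z ⟩ × v ∈⟨ z ⟩
  GenCyclic⇒∈⟨⟩ (z , gen) = z , proj₁ (gen _) fst∈⟨,⟩ , proj₁ (gen _) snd∈⟨,⟩

  GenCyclic-intro : ∀ {u v z} → u ∈⟨ z ⟩ → v ∈⟨ z ⟩ → InGen2 z u v → GenCyclic u v
  GenCyclic-intro {u} {v} {z} u∈z v∈z (i , j , z≈) = z , λ w → into , out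
    where
    into : ∀ {w} → InGen2 w u v → w ∈⟨ z ⟩
    into (k , l , w≈) = ∈⟨⟩-trans (≈⇒∈⟨⟩ w≈)
      (∙-∈⟨⟩ (∈⟨⟩-trans (pow∈⟨⟩ k) u∈z) (∈⟨⟩-trans (pow∈⟨⟩ l) v∈z))
    out : ∀ {w} → w ∈⟨ z ⟩ → InGen2 w u v
    out {w} (m , w≈zᵐ) = m * i , m * j , (begin
      w                                  ≈⟨ w≈zᵐ ⟩
      pow z m                            ≈⟨ pow-cong m z≈ ⟩
      pow (pow u i ∙ pow v j) m          ≈⟨ pow-distrib-∙ _ _ m ⟩
      pow (pow u i) m ∙ pow (pow v j) m  ≈⟨ ∙-cong (pow-pow u i m) (pow-pow v j m) ⟩
      pow u (m * i) ∙ pow v (m * j)      ∎)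

  GenCyclic-sym : ∀ {u v} → GenCyclic u v → GenCyclic v u
  GenCyclic-sym (z , gen) = z , λ w → proj₁ (gen w) ∘ InGen2-swap , InGen2-swap ∘ proj₂ (gen w)

  PowAdj-sym : ∀ {u v} → PowAdj u v → PowAdj v u
  PowAdj-sym (u≉v , adj) = u≉v ∘ sym , ⊎.swap adj

  DiffAdj-sym : ∀ {u v} → DiffAdj u v → DiffAdj v u
  DiffAdj-sym ((u≉v , cyclic) , ¬pow) = (u≉v ∘ sym , GenCyclic-sym cyclic) , ¬pow ∘ PowAdj-sym

  module Exponent (N : ℕ) .{{_ : NonZero N}} (pow-N : ∀ x → pow x N ≈ ε) where

    pow-*N : ∀ x m → pow x (m * N) ≈ ε
    pow-*N x m = trans (pow-*-cong N m (pow-N x)) (pow-ε m)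

    pow-+*N : ∀ x m k → pow x (m + k * N) ≈ pow x m
    pow-+*N x m k = trans (pow-homo-+ x m (k * N)) (trans (∙-congˡ (pow-*N x k)) (identityʳ _))

    pow-≡-mod : ∀ x {m n} i j → m + i * N ≡ n + j * N → pow x m ≈ pow x n
    pow-≡-mod x {m} {n} i j eq =
      trans (sym (pow-+*N x m i)) (trans (reflexive (≡.cong (pow x) eq)) (pow-+*N x n j))

    pow-% : ∀ x m → pow x m ≈ pow x (m % N)
    pow-% x m = pow-≡-mod x 0 (m / N) (≡.trans (+-identityʳ m) (m≡m%n+[m/n]*n m N))

    pow-gcd∈⟨pow⟩ : ∀ x m → pow x (gcd m N) ∈⟨ pow x m ⟩
    pow-gcd∈⟨pow⟩ x m with Bézout.identity (gcd-GCD m N)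
    ... | Bézout.+- s t eq = s , (begin
      pow x (gcd m N)  ≈⟨ pow-≡-mod x t 0 (≡.trans eq (≡.sym (+-identityʳ (s * m)))) ⟩
      pow x (s * m)    ≈⟨ pow-pow x m s ⟨
      pow (pow x m) s  ∎)
    ... | Bézout.-+ s t eq = pred N * s , (begin
      pow x (gcd m N)            ≈⟨ pow-≡-mod x (s * m) t (d+c≡y*n⇒d+c*n≡pred[n]*c+y*n {y = t} eq) ⟩
      pow x (pred N * (s * m))   ≡⟨ ≡.cong (pow x) (≡.sym (*-assoc (pred N) s m)) ⟩
      pow x (pred N * s * m)     ≈⟨ pow-pow x m (pred N * s) ⟨
      pow (pow x m) (pred N * s) ∎)

module FiniteGroup (K : FiniteAbelianGroup) where
  open FiniteAbelianGroup K
  open AbGroupNotions abGroup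
  open CyclicSubgroups abGroup public
  open Mult commutativeMonoid using () renaming (_×_ to _·_)
  open Sum commutativeMonoid using (sum; ∑-distrib-+; sum-replicate; sum-permute; sum-cong-≋)
  open GroupProperties group using (identityˡ-unique)
  open import Relation.Binary.Reasoning.Setoid setoid

  instance
    order-nonZero : NonZero order
    order-nonZero = nonZeroIndex (proj₁ (enum-surjective ε))

  index : Carrier → Fin order
  index x = proj₁ (enum-surjective x)

  enum-index : ∀ x → enum (index x) ≈ x
  enum-index x = proj₂ (enum-surjective x)

  ≈-dec : Decidable _≈_
  ≈-dec x y = map′
    (λ eq → trans (sym (enum-index x)) (trans (reflexive (≡.cong enum eq)) (enum-index y)))
    (λ x≈y → enum-injective _ _ (trans (enum-index x) (trans x≈y (sym (enum-index y)))))
    (index x ≟ᶠ index y)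

  translate-cancel : ∀ {x y} i → x ∙ y ≈ ε → index (x ∙ enum (index (y ∙ enum i))) ≡ i
  translate-cancel {x} {y} i x∙y≈ε = enum-injective _ _ (begin
    enum (index (x ∙ enum (index (y ∙ enum i))))  ≈⟨ enum-index _ ⟩
    x ∙ enum (index (y ∙ enum i))                 ≈⟨ ∙-congˡ (enum-index _) ⟩
    x ∙ (y ∙ enum i)                              ≈⟨ assoc x y (enum i) ⟨
    (x ∙ y) ∙ enum i                              ≈⟨ ∙-congʳ x∙y≈ε ⟩
    ε ∙ enum i                                    ≈⟨ identityˡ (enum i) ⟩
    enum i                                        ∎)

  translation : Carrier → Permutation′ order
  translation x = permutation (λ i → index (x ∙ enum i)) (λ i → index (x ⁻¹ ∙ enum i))
    (λ i → translate-cancel i (inverseʳ x)) (λ i → translate-cancel i (inverseˡ x))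

  -- Translating by x permutes the elements, so it fixes their product.
  pow-order≈ε : ∀ x → pow x order ≈ ε
  pow-order≈ε x = identityˡ-unique (pow x order) (sum enum) (begin
    pow x order ∙ sum enum                        ≡⟨ ≡.cong (_∙ sum enum) (pow≡· x order) ⟩
    order · x ∙ sum enum                          ≈⟨ ∙-congʳ (sum-replicate order) ⟨
    sum {order} (λ _ → x) ∙ sum enum              ≈⟨ ∑-distrib-+ (λ _ → x) enum ⟨
    sum (λ i → x ∙ enum i)                        ≈⟨ sum-cong-≋ (λ i → enum-index (x ∙ enum i)) ⟨
    sum (λ i → enum (index (x ∙ enum i)))         ≈⟨ sum-permute enum (translation x) ⟨
    sum enum                                      ∎)

  open Exponent order pow-order≈ε public

  ∈⟨⟩-dec : Decidable _∈⟨_⟩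
  ∈⟨⟩-dec y x = map′ (λ (i , y≈xⁱ) → toℕ i , y≈xⁱ) below-order
    (any? λ i → ≈-dec y (pow x (toℕ i)))
    where
    below-order : y ∈⟨ x ⟩ → ∃ λ (i : Fin order) → y ≈ pow x (toℕ i)
    below-order (m , y≈xᵐ) = fromℕ< (m%n<n m order) ,
      trans y≈xᵐ (trans (pow-% x m)
                        (reflexive (≡.cong (pow x) (≡.sym (toℕ-fromℕ< (m%n<n m order))))))

  ¬InM⇒< : ∀ {x} → ¬ InM x → ∃ λ z → x < z
  ¬InM⇒< {x} ¬max with any? (λ i → ∈⟨⟩-dec x (enum i) ×-dec ¬? (∈⟨⟩-dec (enum i) x))
  ... | yes (i , x<i) = enum i , x<i
  ... | no ∄ = ⊥-elim (¬max λ z x⊆z w w∈z → ∈⟨⟩-trans w∈z (above⇒below (x⊆z x ∈⟨⟩-refl)))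
    where
    above⇒below : ∀ {z} → x ∈⟨ z ⟩ → z ∈⟨ x ⟩
    above⇒below {z} x∈z = decidable-stable (∈⟨⟩-dec z x) λ z∉x →
      ∄ (index z , ∈⟨⟩-trans x∈z (≈⇒∈⟨⟩ (sym (enum-index z))) ,
                   z∉x ∘ ∈⟨⟩-trans (≈⇒∈⟨⟩ (sym (enum-index z))))

module PGroup (K : FiniteAbelianGroup) {p} (p-prime : Prime p) (K-p : IsPGroup p K) where
  open FiniteAbelianGroup K
  open AbGroupNotions abGroup
  open FiniteGroup K

  gcd∣p^k : ∀ m → gcd m order ∣ p ^ proj₁ K-p
  gcd∣p^k m = ≡.subst (gcd m order ∣_) (proj₂ K-p) (gcd[m,n]∣n m order)

  pow-comparable : ∀ x i j → pow x i ∈⟨ pow x j ⟩ ⊎ pow x j ∈⟨ pow x i ⟩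
  pow-comparable x i j with ∣p^k-total p-prime (proj₁ K-p) (gcd∣p^k i) (gcd∣p^k j)
  ... | inj₁ dᵢ∣dⱼ = inj₂ (∈⟨⟩-trans (∣⇒pow∈⟨pow⟩ (gcd[m,n]∣m j order))
                          (∈⟨⟩-trans (∣⇒pow∈⟨pow⟩ dᵢ∣dⱼ) (pow-gcd∈⟨pow⟩ x i)))
  ... | inj₂ dⱼ∣dᵢ = inj₁ (∈⟨⟩-trans (∣⇒pow∈⟨pow⟩ (gcd[m,n]∣m i order))
                          (∈⟨⟩-trans (∣⇒pow∈⟨pow⟩ dⱼ∣dᵢ) (pow-gcd∈⟨pow⟩ x j)))

  ∈⟨⟩-totalBelow : TotalBelow
  ∈⟨⟩-totalBelow {x} {y} {z} (i , x≈zⁱ) (j , y≈zʲ) =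
    ⊎.map (transport x≈zⁱ y≈zʲ) (transport y≈zʲ x≈zⁱ) (pow-comparable z i j)
    where
    transport : ∀ {u v u′ v′} → u ≈ u′ → v ≈ v′ → u′ ∈⟨ v′ ⟩ → u ∈⟨ v ⟩
    transport u≈u′ v≈v′ u′∈v′ = ∈⟨⟩-trans (≈⇒∈⟨⟩ u≈u′) (∈⟨⟩-trans u′∈v′ (≈⇒∈⟨⟩ (sym v≈v′)))

module _ (G H : FiniteAbelianGroup) where
  private
    module G where
      open FiniteAbelianGroup G public
      open AbGroupNotions abGroup public
      open FiniteGroup G public
    module H where
      open FiniteAbelianGroup H public
      open AbGroupNotions abGroup public
      open FiniteGroup H public

  separatingExponent : Coprime G.order H.order →
    ∃ λ E → (∀ x → G.pow x E G.≈ x) × (∀ y → H.pow y E H.≈ H.ε)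
  separatingExponent coprime with coprime-Bézout coprime
  ... | Bézout.-+ s t eq = t * H.order ,
    (λ x → G.trans (G.pow-≡-mod x 0 s (≡.trans (+-identityʳ _) (≡.sym eq))) (G.identityʳ x)) ,
    (λ y → H.pow-*N y t)
  ... | Bézout.+- s t eq = pred G.order * (t * H.order) ,
    (λ x → G.trans (G.pow-≡-mod x s (t * H.order) (≡.sym (d+c≡y*n⇒d+c*n≡pred[n]*c+y*n {y = s} eq)))
                   (G.identityʳ x)) ,
    (λ y → H.trans (H.pow-*-cong (t * H.order) (pred G.order) (H.pow-*N y t))
                   (H.pow-ε (pred G.order)))

module PrimePowerProduct {p q} (p-prime : Prime p) (q-prime : Prime q) (p≢q : p ≢ q)
  (P Q : FiniteAbelianGroup) (P-p : IsPGroup p P) (Q-q : IsPGroup q Q) where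
  module P where
    open FiniteAbelianGroup P public
    open AbGroupNotions abGroup public
    open FiniteGroup P public
    open PGroup P p-prime P-p public
  module Q where
    open FiniteAbelianGroup Q public
    open AbGroupNotions abGroup public
    open FiniteGroup Q public
    open PGroup Q q-prime Q-q public
  open AbelianGroup (P ⊗ Q) using (_≈_; _∙_)
  open AbGroupNotions (P ⊗ Q)
  open CyclicSubgroups (P ⊗ Q) using (GenCyclic-intro; GenCyclic⇒∈⟨⟩; DiffAdj-sym)
  open CrossRelation P.∈⟨⟩-preorder Q.∈⟨⟩-preorder using (Cross; SameNbhd)

  coprime-orders : Coprime P.order Q.order
  coprime-orders = ≡.subst₂ Coprime (≡.sym (proj₂ P-p)) (≡.sym (proj₂ Q-q))
    (coprime-^ p-prime q-prime p≢q (proj₁ P-p) (proj₁ Q-q))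

  E₁ E₂ : ℕ
  E₁ = proj₁ (separatingExponent P Q coprime-orders)
  E₂ = proj₁ (separatingExponent Q P (Coprime-sym coprime-orders))

  P-E₁ : ∀ x → P.pow x E₁ P.≈ x
  P-E₁ = proj₁ (proj₂ (separatingExponent P Q coprime-orders))

  Q-E₁ : ∀ y → Q.pow y E₁ Q.≈ Q.ε
  Q-E₁ = proj₂ (proj₂ (separatingExponent P Q coprime-orders))

  Q-E₂ : ∀ y → Q.pow y E₂ Q.≈ y
  Q-E₂ = proj₁ (proj₂ (separatingExponent Q P (Coprime-sym coprime-orders)))

  P-E₂ : ∀ x → P.pow x E₂ P.≈ P.ε
  P-E₂ = proj₂ (proj₂ (separatingExponent Q P (Coprime-sym coprime-orders)))

  pow-, : ∀ x y m → pow (x , y) m ≡ (P.pow x m , Q.pow y m)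
  pow-, x y zero = ≡.refl
  pow-, x y (suc m) = ≡.cong ((x , y) ∙_) (pow-, x y m)

  ∈⟨,⟩⇒ : ∀ {x y x′ y′} → (x′ , y′) ∈⟨ (x , y) ⟩ → x′ P.∈⟨ x ⟩ × y′ Q.∈⟨ y ⟩
  ∈⟨,⟩⇒ {x} {y} {x′} {y′} (m , eq) with ≡.subst ((x′ , y′) ≈_) (pow-, x y m) eq
  ... | x′≈xᵐ , y′≈yᵐ = (m , x′≈xᵐ) , (m , y′≈yᵐ)

  ∈⟨,⟩⇐ : ∀ {x y x′ y′} → x′ P.∈⟨ x ⟩ → y′ Q.∈⟨ y ⟩ → (x′ , y′) ∈⟨ (x , y) ⟩
  ∈⟨,⟩⇐ {x} {y} (i , x′≈xⁱ) (j , y′≈yʲ) = i * E₁ + j * E₂ ,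
    ≡.subst (_ ≈_) (≡.sym (pow-, x y (i * E₁ + j * E₂)))
      ( P.trans x′≈xⁱ (P.sym (P.trans (P.pow-+-*-cong E₁ E₂ i j (P-E₁ x) (P-E₂ x))
                                      (P.trans (P.∙-congˡ (P.pow-ε j)) (P.identityʳ _))))
      , Q.trans y′≈yʲ (Q.sym (Q.trans (Q.pow-+-*-cong E₁ E₂ i j (Q-E₁ y) (Q-E₂ y))
                                      (Q.trans (Q.∙-congʳ (Q.pow-ε i)) (Q.identityˡ _)))))

  ⟨,⟩∋mixed : ∀ x y x′ y′ → InGen2 (x , y′) (x , y) (x′ , y′)
  ⟨,⟩∋mixed x y x′ y′ = E₁ , E₂ ,
    ≡.subst₂ (λ u v → (x , y′) ≈ u ∙ v) (≡.sym (pow-, x y E₁)) (≡.sym (pow-, x′ y′ E₂))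
      ( P.sym (P.trans (P.∙-cong (P-E₁ x) (P-E₂ x′)) (P.identityʳ x))
      , Q.sym (Q.trans (Q.∙-cong (Q-E₁ y) (Q-E₂ y′)) (Q.identityˡ y′)))

  <×>⇒DiffAdj : ∀ {x y x′ y′} → x′ P.< x → y Q.< y′ → DiffAdj (x , y) (x′ , y′)
  <×>⇒DiffAdj {x} {y} {x′} {y′} (x′∈x , x∉x′) (y∈y′ , y′∉y) = (distinct , cyclic) , ¬pow
    where
    distinct : ¬ (x , y) ≈ (x′ , y′)
    distinct (x≈x′ , _) = x∉x′ (P.≈⇒∈⟨⟩ x≈x′)
    cyclic : GenCyclic (x , y) (x′ , y′)
    cyclic = GenCyclic-intro (∈⟨,⟩⇐ P.∈⟨⟩-refl y∈y′) (∈⟨,⟩⇐ x′∈x Q.∈⟨⟩-refl) (⟨,⟩∋mixed x y x′ y′)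
    ¬pow : ¬ PowAdj (x , y) (x′ , y′)
    ¬pow (_ , inj₁ v∈u) = y′∉y (proj₂ (∈⟨,⟩⇒ v∈u))
    ¬pow (_ , inj₂ u∈v) = x∉x′ (proj₁ (∈⟨,⟩⇒ u∈v))

  Cross⇒DiffAdj : ∀ {u v} → Cross u v → DiffAdj u v
  Cross⇒DiffAdj {_ , _} {_ , _} (inj₁ (x′<x , y<y′)) = <×>⇒DiffAdj x′<x y<y′
  Cross⇒DiffAdj {_ , _} {_ , _} (inj₂ (x<x′ , y′<y)) = DiffAdj-sym (<×>⇒DiffAdj x<x′ y′<y)

  -- Both points lie in one cyclic group, whose p- and q-parts are chains; non-adjacency
  -- in the power graph rules out the two comparable configurations.
  DiffAdj⇒Cross : ∀ {u v} → DiffAdj u v → Cross u v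
  DiffAdj⇒Cross {x , y} {x′ , y′} ((u≉v , cyclic) , ¬pow) with GenCyclic⇒∈⟨⟩ cyclic
  ... | z , u∈z , v∈z = cases
    (P.∈⟨⟩-totalBelow (proj₁ (∈⟨,⟩⇒ u∈z)) (proj₁ (∈⟨,⟩⇒ v∈z)))
    (Q.∈⟨⟩-totalBelow (proj₂ (∈⟨,⟩⇒ u∈z)) (proj₂ (∈⟨,⟩⇒ v∈z)))
    where
    ¬below : x P.∈⟨ x′ ⟩ → ¬ y Q.∈⟨ y′ ⟩
    ¬below x∈x′ y∈y′ = ¬pow (u≉v , inj₂ (∈⟨,⟩⇐ x∈x′ y∈y′))
    ¬above : x′ P.∈⟨ x ⟩ → ¬ y′ Q.∈⟨ y ⟩
    ¬above x′∈x y′∈y = ¬pow (u≉v , inj₁ (∈⟨,⟩⇐ x′∈x y′∈y))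
    cases : x P.∈⟨ x′ ⟩ ⊎ x′ P.∈⟨ x ⟩ → y Q.∈⟨ y′ ⟩ ⊎ y′ Q.∈⟨ y ⟩ → Cross (x , y) (x′ , y′)
    cases (inj₁ x∈x′) (inj₁ y∈y′) = ⊥-elim (¬below x∈x′ y∈y′)
    cases (inj₁ x∈x′) (inj₂ y′∈y) = inj₂ ((x∈x′ , λ x′∈x → ¬above x′∈x y′∈y) , (y′∈y , ¬below x∈x′))
    cases (inj₂ x′∈x) (inj₁ y∈y′) = inj₁ ((x′∈x , λ x∈x′ → ¬below x∈x′ y∈y′) , (y∈y′ , ¬above x′∈x))
    cases (inj₂ x′∈x) (inj₂ y′∈y) = ⊥-elim (¬above x′∈x y′∈y)

  SameDiffNbhd⇔SameNbhd : ∀ {u v} → (∀ w → DiffAdj u w ⇔ DiffAdj v w) ⇔ SameNbhd u v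
  SameDiffNbhd⇔SameNbhd =
    (λ same w → DiffAdj⇒Cross ∘ proj₁ (same w) ∘ Cross⇒DiffAdj ,
                DiffAdj⇒Cross ∘ proj₂ (same w) ∘ Cross⇒DiffAdj) ,
    (λ same w → Cross⇒DiffAdj ∘ proj₁ (same w) ∘ DiffAdj⇒Cross ,
                Cross⇒DiffAdj ∘ proj₂ (same w) ∘ DiffAdj⇒Cross)

lemma3p4 : (p q : ℕ) → Prime p → Prime q → ¬ p ≡ q
    → (P Q : FiniteAbelianGroup) → IsPGroup p P → IsPGroup q Q
    → (a : FiniteAbelianGroup.Carrier P) → (b : FiniteAbelianGroup.Carrier Q)
    → ¬ FiniteAbelianGroup._≈_ P a (FiniteAbelianGroup.ε P)
    → ¬ FiniteAbelianGroup._≈_ Q b (FiniteAbelianGroup.ε Q)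
    → ¬ AbGroupNotions.InM (FiniteAbelianGroup.abGroup P) a
    → ¬ AbGroupNotions.InM (FiniteAbelianGroup.abGroup Q) b
    → (x : FiniteAbelianGroup.Carrier P) → (y : FiniteAbelianGroup.Carrier Q)
    → AbGroupNotions.InNbhdClass (P ⊗ Q) (a , b) (x , y)
    ⇔ (AbGroupNotions.SameCyc (FiniteAbelianGroup.abGroup P) x a
    × AbGroupNotions.SameCyc (FiniteAbelianGroup.abGroup Q) y b)
lemma3p4 p q p-prime q-prime p≢q P Q P-p Q-q a b a≉ε b≉ε a∉M b∉M x y = inClass⇒ , ⇒inClass
  where
  open PrimePowerProduct p-prime q-prime p≢q P Q P-p Q-q
  open CrossRelation P.∈⟨⟩-preorder Q.∈⟨⟩-preorder
  open AbGroupNotions (P ⊗ Q) using (InNbhdClass)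

  inClass⇒ : InNbhdClass (a , b) (x , y) → P.SameCyc x a × Q.SameCyc y b
  inClass⇒ (_ , same) =
    proj₂ P.SameCyc⇔≃ (SameNbhd⇒≃₁ P.∈⟨⟩-dec P.∈⟨⟩-totalBelow Q.ε-minimum
                         (Q.ε< b≉ε) (proj₂ (P.¬InM⇒< a∉M)) sameCross) ,
    proj₂ Q.SameCyc⇔≃ (SameNbhd⇒≃₂ P.∈⟨⟩-preorder Q.∈⟨⟩-preorder Q.∈⟨⟩-dec Q.∈⟨⟩-totalBelow P.ε-minimum
                         (P.ε< a≉ε) (proj₂ (Q.¬InM⇒< b∉M)) sameCross)
    where
    sameCross : SameNbhd (x , y) (a , b)
    sameCross = proj₁ SameDiffNbhd⇔SameNbhd same

  ⇒inClass : P.SameCyc x a × Q.SameCyc y b → InNbhdClass (a , b) (x , y)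
  ⇒inClass (x~a , y~b) with proj₁ P.SameCyc⇔≃ x~a | proj₁ Q.SameCyc⇔≃ y~b | P.¬InM⇒< a∉M
  ... | x≃a | y≃b | z , a<z = ((z , Q.ε) , Cross⇒DiffAdj (inj₂ (x<z , ε<y))) ,
                              proj₂ SameDiffNbhd⇔SameNbhd (≃⇒SameNbhd x≃a y≃b)
    where
    x<z : x P.< z
    x<z = <₁-resp-≃ (Prod.swap x≃a) ≃₁-refl a<z
    ε<y : Q.ε Q.< y
    ε<y = <₂-resp-≃ ≃₂-refl (Prod.swap y≃b) (Q.ε< b≉ε)
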